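{- Given a finite forest $\mathbf{A}$ of finite rooted trees and a strictly positive integer $k$, one can compute (algorithmically) a forest $\mathbf{X}$ such that $\mathbf{X}^k=\mathbf{A}$, whenever such a forest exists (and otherwise report that none exists).
   Context: Rooted trees are in-trees (arcs oriented toward the root); the depth of a node is its distance to the root. The product of two rooted trees $\mathbf{t}_1=(V_1,E_1)$, $\mathbf{t}_2=(V_2,E_2)$ is the rooted tree with vertex set $\{(v,u)\in V_1\times V_2\mid \mathrm{depth}(v)=\mathrm{depth}(u)\}$ and arcs $((v,u),(v',u'))$ whenever $(v,v')\in E_1$ and $(u,u')\in E_2$. A forest is a multiset of rooted trees up to isomorphism; the sum of forests is multiset union and the product of two forests is the multiset of all pairwise products of their trees. $\mathbf{X}^k$ denotes the product of $k$ copies of $\mathbf{X}$. Equality means isomorphism. -}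

module Defs where

open import Data.Nat using (ℕ; zero; suc; NonZero)
open import Data.List using (List; []; _∷_; map; concatMap)
open import Data.List.Relation.Binary.Permutation.Homogeneous using (Permutation)

-- A finite rooted tree (in-tree): a root together with the list of subtrees
-- hanging from its in-neighbours (the vertices whose arc points to the root).
data Tree : Set where
  node : List Tree → Tree

-- Forest: a finite multiset of trees, represented by a list (order irrelevant
-- up to the isomorphism _≅F_ below).
Forest : Set
Forest = List Tree

data _≅_ : Tree → Tree → Set where
  node : ∀ {ts us} → Permutation _≅_ ts us → node ts ≅ node us

_≅F_ : Forest → Forest → Set
_≅F_ = Permutation _≅_

-- Product of rooted trees: vertices are pairs of equal depth, arcs are pairs
-- of arcs.
mutual
  _⊗_ : Tree → Tree → Tree
  node ts ⊗ node us = node (prodL ts us)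

  prodL : List Tree → List Tree → List Tree
  prodL [] us = []
  prodL (t ∷ ts) us = prodR t us ++' prodL ts us

  prodR : Tree → List Tree → List Tree
  prodR t [] = []
  prodR t (u ∷ us) = (t ⊗ u) ∷ prodR t us

  _++'_ : List Tree → List Tree → List Tree
  [] ++' ys = ys
  (x ∷ xs) ++' ys = x ∷ (xs ++' ys)

_⊗F_ : Forest → Forest → Forest
_⊗F_ = prodL

power : (k : ℕ) → .{{NonZero k}} → Forest → Forest
power (suc zero) X = X
power (suc (suc n)) X = X ⊗F power (suc n) X

module Submission where

open import Defs
open import Data.Nat using (ℕ; NonZero)
open import Data.Product using (Σ)
open import Relation.Nullary using (Dec)

open import Data.Nat using (zero; suc; _+_; _*_; _≤_; z≤n; s≤s)
open import Data.Nat.Properties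
open import Data.Nat.ListAction using (sum)
open import Data.Nat.ListAction.Properties using (sum-++)
open import Data.List using (List; []; _∷_; _++_; [_]; length; map; cartesianProductWith)
open import Data.List.Properties using (map-++)
import Data.List.Relation.Binary.Permutation.Homogeneous as H
open import Data.List.Relation.Binary.Pointwise using (Pointwise; []; _∷_)
import Data.List.Relation.Binary.Permutation.Setoid as SetoidPermutation
import Data.List.Relation.Binary.Permutation.Setoid.Properties as SetoidPermutationProperties
import Data.List.Relation.Binary.Equality.Setoid as SetoidEquality
open import Data.List.Relation.Unary.All as All using (All; []; _∷_)
open import Data.List.Relation.Unary.Any using (here; there; any?; satisfied)
open import Data.List.Membership.Propositional using (_∈_; lose)
open import Data.List.Membership.Propositional.Properties using (∈-map⁺; ∈-cartesianProductWith⁺)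
open import Data.List.Membership.Setoid.Properties using (∈-∃++)
open import Data.Product using (_,_)
open import Function using (_∘_)
open import Relation.Nullary using (yes; no)
open import Relation.Binary.Bundles using (Setoid)
open import Relation.Binary.PropositionalEquality as P using (_≡_; refl; cong)

-- The brute-force algorithm is sound and complete because the number of
-- vertices at depth d is multiplicative for the product and invariant under
-- isomorphism.  Hence a k-th root X of A has at each depth at most as many
-- vertices as A, so X lies in the finite list of forests whose height and
-- level widths are bounded by the size of A, and it suffices to test each
-- of them, tree isomorphism being decidable.

-- The generic lemmas on Pointwise and Permutation cannot be used for
-- _≅_ itself: the termination checker does not see through them.
mutual
  ≅-refl : ∀ t → t ≅ t
  ≅-refl (node ts) = node (H.refl (pointwise-≅-refl ts))

  pointwise-≅-refl : ∀ ts → Pointwise _≅_ ts ts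
  pointwise-≅-refl [] = []
  pointwise-≅-refl (t ∷ ts) = ≅-refl t ∷ pointwise-≅-refl ts

mutual
  ≅-sym : ∀ {t u} → t ≅ u → u ≅ t
  ≅-sym (node p) = node (≅F-sym p)

  ≅F-sym : ∀ {ts us} → ts ≅F us → us ≅F ts
  ≅F-sym (H.refl pw) = H.refl (pointwise-≅-sym pw)
  ≅F-sym (H.prep e p) = H.prep (≅-sym e) (≅F-sym p)
  ≅F-sym (H.swap e₁ e₂ p) = H.swap (≅-sym e₂) (≅-sym e₁) (≅F-sym p)
  ≅F-sym (H.trans p q) = H.trans (≅F-sym q) (≅F-sym p)

  pointwise-≅-sym : ∀ {ts us} → Pointwise _≅_ ts us → Pointwise _≅_ us ts
  pointwise-≅-sym [] = []
  pointwise-≅-sym (e ∷ pw) = ≅-sym e ∷ pointwise-≅-sym pw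

≅-trans : ∀ {t u v} → t ≅ u → u ≅ v → t ≅ v
≅-trans (node p) (node q) = node (H.trans p q)

≅-setoid : Setoid _ _
≅-setoid = record
  { Carrier = Tree
  ; _≈_ = _≅_
  ; isEquivalence = record { refl = ≅-refl _ ; sym = ≅-sym ; trans = ≅-trans }
  }

module PermutationDecidable {a ℓ} (S : Setoid a ℓ) where
  open Setoid S using (_≈_) renaming (Carrier to A; refl to ≈-refl; sym to ≈-sym; trans to ≈-trans)
  open SetoidPermutation S using (_↭_; ↭-refl; ↭-sym; ↭-trans; ↭-reflexive-≋)
  open SetoidPermutationProperties S using (xs↭ys⇒|xs|≡|ys|; Any-resp-↭; shift; dropMiddleElement)
  open SetoidEquality S using (≋-sym)

  -- Asking for decidability only at the elements of xs lets _≅?_ below recurse structurally.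
  ↭-dec : (xs ys : List A) → All (λ x → ∀ y → Dec (x ≈ y)) xs → Dec (xs ↭ ys)
  ↭-dec [] [] [] = yes ↭-refl
  ↭-dec [] (y ∷ ys) [] = no λ p → 0≢1+n (xs↭ys⇒|xs|≡|ys| p)
  ↭-dec (x ∷ xs) ys (x≈? ∷ xs≈?) with any? x≈? ys
  ... | no x∉ys = no λ p → x∉ys (Any-resp-↭ (λ y≈z x≈y → ≈-trans x≈y y≈z) p (here ≈-refl))
  ... | yes x∈ys with ∈-∃++ S x∈ys
  ...   | ws , zs , y , x≈y , ys≋ with ↭-dec xs (ws ++ zs) xs≈?
  ...     | yes p = yes (↭-trans (H.prep x≈y p)
              (↭-trans (↭-sym (shift ≈-refl ws zs)) (↭-reflexive-≋ (≋-sym ys≋))))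
  ...     | no ¬p = no λ q → ¬p (dropMiddleElement [] ws
              (↭-trans (H.prep (≈-sym x≈y) ↭-refl) (↭-trans q (↭-reflexive-≋ ys≋))))

open PermutationDecidable ≅-setoid using (↭-dec)

mutual
  _≅?_ : (t u : Tree) → Dec (t ≅ u)
  node ts ≅? node us with ↭-dec ts us (≅?-all ts)
  ... | yes p = yes (node p)
  ... | no ¬p = no λ { (node p) → ¬p p }

  ≅?-all : (ts : List Tree) → All (λ t → ∀ u → Dec (t ≅ u)) ts
  ≅?-all [] = []
  ≅?-all (t ∷ ts) = (t ≅?_) ∷ ≅?-all ts

_≅F?_ : (F G : Forest) → Dec (F ≅F G)
F ≅F? G = ↭-dec F G (≅?-all F)

levelT : ℕ → Tree → ℕ
levelT zero t = 1
levelT (suc d) (node ts) = sum (map (levelT d) ts)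

levelF : ℕ → Forest → ℕ
levelF d F = sum (map (levelT d) F)

levelF-zero : ∀ F → levelF 0 F ≡ length F
levelF-zero [] = refl
levelF-zero (t ∷ F) = cong suc (levelF-zero F)

∈⇒≤sum : ∀ {n ns} → n ∈ ns → n ≤ sum ns
∈⇒≤sum {ns = n ∷ ns} (here refl) = m≤m+n n (sum ns)
∈⇒≤sum {ns = m ∷ ns} (there n∈ns) = ≤-trans (∈⇒≤sum n∈ns) (m≤n+m (sum ns) m)

levelF-subforest : ∀ d {ts F} → node ts ∈ F → levelF d ts ≤ levelF (suc d) F
levelF-subforest d t∈F = ∈⇒≤sum (∈-map⁺ (levelT (suc d)) t∈F)

sum-map-↭ : ∀ {f : Tree → ℕ} → (∀ {t u} → t ≅ u → f t ≡ f u) →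
            ∀ {F G} → F ≅F G → sum (map f F) ≡ sum (map f G)
sum-map-↭ f-≅ p = foldr-commMonoid +-0-isCommutativeMonoid (map⁺ (P.setoid ℕ) f-≅ p)
  where
    open SetoidPermutationProperties ≅-setoid using (map⁺)
    open SetoidPermutationProperties (P.setoid ℕ) using (foldr-commMonoid)

levelT-≅ : ∀ d {t u} → t ≅ u → levelT d t ≡ levelT d u
levelT-≅ zero _ = refl
levelT-≅ (suc d) (node p) = sum-map-↭ (levelT-≅ d) p

levelF-≅ : ∀ d {F G} → F ≅F G → levelF d F ≡ levelF d G
levelF-≅ d = sum-map-↭ (levelT-≅ d)

++'≡++ : ∀ (xs ys : List Tree) → xs ++' ys ≡ xs ++ ys
++'≡++ [] ys = refl
++'≡++ (x ∷ xs) ys = cong (x ∷_) (++'≡++ xs ys)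

module _ {f : Tree → ℕ} (f-⊗ : ∀ t u → f (t ⊗ u) ≡ f t * f u) where
  open P.≡-Reasoning

  sum-map-prodR : ∀ t us → sum (map f (prodR t us)) ≡ f t * sum (map f us)
  sum-map-prodR t [] = P.sym (*-zeroʳ (f t))
  sum-map-prodR t (u ∷ us) = begin
    f (t ⊗ u) + sum (map f (prodR t us)) ≡⟨ P.cong₂ _+_ (f-⊗ t u) (sum-map-prodR t us) ⟩
    f t * f u + f t * sum (map f us)     ≡⟨ *-distribˡ-+ (f t) (f u) _ ⟨
    f t * (f u + sum (map f us))         ∎

  sum-map-prodL : ∀ ts us → sum (map f (prodL ts us)) ≡ sum (map f ts) * sum (map f us)
  sum-map-prodL [] us = refl
  sum-map-prodL (t ∷ ts) us = begin
    sum (map f (prodR t us ++' prodL ts us))                ≡⟨ cong (sum ∘ map f) (++'≡++ (prodR t us) _) ⟩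
    sum (map f (prodR t us ++ prodL ts us))                 ≡⟨ cong sum (map-++ f (prodR t us) _) ⟩
    sum (map f (prodR t us) ++ map f (prodL ts us))         ≡⟨ sum-++ (map f (prodR t us)) _ ⟩
    sum (map f (prodR t us)) + sum (map f (prodL ts us))    ≡⟨ P.cong₂ _+_ (sum-map-prodR t us) (sum-map-prodL ts us) ⟩
    f t * sum (map f us) + sum (map f ts) * sum (map f us)  ≡⟨ *-distribʳ-+ (sum (map f us)) (f t) _ ⟨
    (f t + sum (map f ts)) * sum (map f us)                 ∎

levelT-⊗ : ∀ d t u → levelT d (t ⊗ u) ≡ levelT d t * levelT d u
levelT-⊗ zero (node ts) (node us) = refl
levelT-⊗ (suc d) (node ts) (node us) = sum-map-prodL (levelT-⊗ d) ts us

levelF-⊗F : ∀ d X Y → levelF d (X ⊗F Y) ≡ levelF d X * levelF d Y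
levelF-⊗F d = sum-map-prodL (levelT-⊗ d)

m≤n⇒m≤m*n : ∀ {m n} → m ≤ n → m ≤ m * n
m≤n⇒m≤m*n {zero} _ = z≤n
m≤n⇒m≤m*n {suc m} {suc n} _ = m≤m*n (suc m) (suc n)

levelF-≤-power : ∀ d k .{{_ : NonZero k}} X → levelF d X ≤ levelF d (power k X)
levelF-≤-power d (suc zero) X = ≤-refl
levelF-≤-power d (suc (suc n)) X =
  ≤-trans (m≤n⇒m≤m*n (levelF-≤-power d (suc n) X))
          (≤-reflexive (P.sym (levelF-⊗F d X (power (suc n) X))))

levelF-≤-root : ∀ {k} .{{_ : NonZero k}} {X A} → power k X ≅F A → ∀ d → levelF d X ≤ levelF d A
levelF-≤-root {k} {X = X} p d = ≤-trans (levelF-≤-power d k X) (≤-reflexive (levelF-≅ d p))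

mutual
  sizeT : Tree → ℕ
  sizeT (node ts) = suc (sizeF ts)

  sizeF : Forest → ℕ
  sizeF [] = 0
  sizeF (t ∷ ts) = sizeT t + sizeF ts

mutual
  levelT≤sizeT : ∀ d t → levelT d t ≤ sizeT t
  levelT≤sizeT zero (node ts) = s≤s z≤n
  levelT≤sizeT (suc d) (node ts) = m≤n⇒m≤1+n (levelF≤sizeF d ts)

  levelF≤sizeF : ∀ d F → levelF d F ≤ sizeF F
  levelF≤sizeF d [] = z≤n
  levelF≤sizeF d (t ∷ F) = +-mono-≤ (levelT≤sizeT d t) (levelF≤sizeF d F)

mutual
  levelT-vanishes : ∀ d t → sizeT t ≤ d → levelT d t ≡ 0
  levelT-vanishes (suc d) (node ts) (s≤s ts≤d) = levelF-vanishes d ts ts≤d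

  levelF-vanishes : ∀ d F → sizeF F ≤ d → levelF d F ≡ 0
  levelF-vanishes d [] _ = refl
  levelF-vanishes d (t ∷ F) tF≤d = P.cong₂ _+_ (levelT-vanishes d t (m+n≤o⇒m≤o (sizeT t) tF≤d))
                                               (levelF-vanishes d F (m+n≤o⇒n≤o (sizeT t) tF≤d))

listsOfLength≤ : ∀ {A : Set} → ℕ → List A → List (List A)
listsOfLength≤ zero L = [ [] ]
listsOfLength≤ (suc n) L = [] ∷ cartesianProductWith _∷_ L (listsOfLength≤ n L)

∈-listsOfLength≤ : ∀ {A : Set} n (L : List A) {xs} → length xs ≤ n → All (_∈ L) xs → xs ∈ listsOfLength≤ n L
∈-listsOfLength≤ zero L {[]} _ _ = here refl
∈-listsOfLength≤ (suc n) L {[]} _ _ = here refl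
∈-listsOfLength≤ (suc n) L (s≤s xs≤n) (x∈L ∷ xs∈L) =
  there (∈-cartesianProductWith⁺ _∷_ x∈L (∈-listsOfLength≤ n L xs≤n xs∈L))

forests : (h w : ℕ) → List Forest
forests zero w = [ [] ]
forests (suc h) w = listsOfLength≤ w (map node (forests h w))

∈-forests : ∀ h w F → (∀ d → levelF d F ≤ w) → levelF h F ≡ 0 → F ∈ forests h w
∈-forests zero w [] _ _ = here refl
∈-forests (suc h) w F F≤w F-h≡0 =
  ∈-listsOfLength≤ w _ (P.subst (_≤ w) (levelF-zero F) (F≤w 0)) (All.tabulate subtree∈)
  where
    subtree∈ : ∀ {t} → t ∈ F → t ∈ map node (forests h w)
    subtree∈ {node ts} t∈F = ∈-map⁺ node (∈-forests h w ts
      (λ d → ≤-trans (levelF-subforest d t∈F) (F≤w (suc d)))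
      (n≤0⇒n≡0 (≤-trans (levelF-subforest h t∈F) (≤-reflexive F-h≡0))))

∈-forests-size : ∀ {X} A → (∀ d → levelF d X ≤ levelF d A) → X ∈ forests (sizeF A) (sizeF A)
∈-forests-size {X} A X≤A = ∈-forests (sizeF A) (sizeF A) X
  (λ d → ≤-trans (X≤A d) (levelF≤sizeF d A))
  (n≤0⇒n≡0 (≤-trans (X≤A (sizeF A)) (≤-reflexive (levelF-vanishes (sizeF A) A ≤-refl))))

theorem3 : (A : Forest) (k : ℕ) .{{_ : NonZero k}} →
    Dec (Σ Forest (λ X → power k X ≅F A))
theorem3 A k with any? (λ X → power k X ≅F? A) (forests (sizeF A) (sizeF A))
... | yes root = yes (satisfied root)
... | no no-root = no λ (X , p) → no-root (lose (∈-forests-size A (levelF-≤-root p)) p)
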